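{- Let $q$ be a prime power and let $p,N$ be integers with $0<p<N$. For all integers $x,r$ with $0\le x\le \min(p-1,N-p)$ and $0\le r\le\min(p,N-p)$, \[ Q_r(N,p;q;x)=\frac{[N]}{[p]}\left(\frac{[p-r]}{[N-2r]}\,Q_r(N-1,p-1;q;x)+q^{p-r+1}\frac{[N-p-r+1]}{[N-2r+2]}\,Q_{r-1}(N-1,p-1;q;x)\right), \] where for $r=0$ the term with $Q_{ -1}(N-1,p-1;q;x)$ is zero, and for $r=p$ the term with $Q_{p}(N-1,p-1;q;x)$ is zero (so the equation reads $Q_p(N,p;q;x)=q\frac{[N][N-2p+1]}{[p][N-2p+2]}Q_{p-1}(N-1,p-1;q;x)$).
   Context: Notation: $[k]=(q^k-1)/(q-1)$; the $q$-binomial coefficient is $\left[\begin{smallmatrix}a\\ b\end{smallmatrix}\right]=\prod_{i=0}^{b-1}\frac{q^a-q^i}{q^b-q^i}$ for integers $b\ge0$ (equal to $1$ for $b=0$), and it is taken to be $0$ for $b<0$. For integers $0<p<N$ and integers $r,x$, the $q$-Hahn polynomial is \[ Q_r(N,p;q;x)=\frac{\left[\begin{smallmatrix}N\\ r\end{smallmatrix}\right]-\left[\begin{smallmatrix}N\\ r-1\end{smallmatrix}\right]}{q^{x^2}\left[\begin{smallmatrix}N-p\\ x\end{smallmatrix}\right]\left[\begin{smallmatrix}p\\ x\end{smallmatrix}\right]}\sum_{u=0}^{x}(-1)^{x-u}q^{ur+\binom{x-u}{2}}\left[\begin{smallmatrix}p-u\\ p-x\end{smallmatrix}\right]\left[\begin{smallmatrix}p-r\\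 u\end{smallmatrix}\right]\left[\begin{smallmatrix}N-p+u-r\\ u\end{smallmatrix}\right] \] when both $r$ and $x$ lie in $\{0,1,\dots,\min(p,N-p)\}$, and $Q_r(N,p;q;x)=0$ if $r$ or $x$ lies outside this set. -}

module Defs where

open import Data.Nat as ℕ using (ℕ; zero; suc)
open import Data.Nat.Primality using (Prime)
open import Data.Integer as ℤ using (ℤ; +_; -[1+_])
open import Data.Rational as ℚ using (ℚ; 0ℚ; 1ℚ; _+_; _-_; _*_; -_; 1/_)
open import Data.Rational.Properties using (_≟_)
open import Data.Product using (Σ; _×_)
open import Relation.Binary.PropositionalEquality using (_≡_)
open import Relation.Nullary using (yes; no)
open import Data.Bool using (if_then_else_)
open import Data.Nat using (_≤ᵇ_)

IsPrimePower : ℕ → Set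
IsPrimePower q = Σ ℕ λ ℓ → Σ ℕ λ k → Prime ℓ × q ≡ ℓ ℕ.^ suc k

-- Total inverse on ℚ (inverse of 0 is 0); only ever applied to nonzero
-- denominators in the statement below.
inv : ℚ → ℚ
inv a with a ≟ 0ℚ
... | yes _ = 0ℚ
... | no ne = 1/_ a {{ℚ.≢-nonZero ne}}

infixl 7 _÷_
_÷_ : ℚ → ℚ → ℚ
a ÷ b = a * inv b

ι : ℕ → ℚ
ι n = + n ℚ./ 1

qpow : ℕ → ℕ → ℚ
qpow q n = ι (q ℕ.^ n)

qint : ℕ → ℕ → ℚ
qint q k = (qpow q k - 1ℚ) ÷ (ι q - 1ℚ)

prodTo : ℕ → (ℕ → ℚ) → ℚ
prodTo zero    f = 1ℚ
prodTo (suc b) f = prodTo b f * f b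

sumUpTo : ℕ → (ℕ → ℚ) → ℚ
sumUpTo zero    f = f 0
sumUpTo (suc x) f = sumUpTo x f + f (suc x)

qbin : ℕ → ℕ → ℤ → ℚ
qbin q a (+ b)    = prodTo b (λ i → (qpow q a - qpow q i) ÷ (qpow q b - qpow q i))
qbin q a -[1+ _ ] = 0ℚ

sign : ℕ → ℚ
sign zero    = 1ℚ
sign (suc n) = - sign n

choose2 : ℕ → ℕ
choose2 n = (n ℕ.* (n ℕ.∸ 1)) ℕ./ 2

QHahnℕ : (q N p r x : ℕ) → ℚ
QHahnℕ q N p r x =
  ((qbin q N (+ r) - qbin q N (+ r ℤ.- ℤ.1ℤ))
    ÷ (qpow q (x ℕ.* x) * qbin q (N ℕ.∸ p) (+ x) * qbin q p (+ x)))
  * sumUpTo x (λ u →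
      sign (x ℕ.∸ u) * qpow q (u ℕ.* r ℕ.+ choose2 (x ℕ.∸ u))
      * qbin q (p ℕ.∸ u) (+ (p ℕ.∸ x))
      * qbin q (p ℕ.∸ r) (+ u)
      * qbin q (N ℕ.∸ p ℕ.+ u ℕ.∸ r) (+ u))

QHahn : (q N p : ℕ) → (r x : ℤ) → ℚ
QHahn q N p (+ r) (+ x) =
  if (r ≤ᵇ ℕ._⊓_ p (N ℕ.∸ p)) Data.Bool.∧ (x ≤ᵇ ℕ._⊓_ p (N ℕ.∸ p))
  then QHahnℕ q N p r x else 0ℚ
QHahn q N p (+ r) -[1+ _ ] = 0ℚ
QHahn q N p -[1+ _ ] x = 0ℚ

{-# OPTIONS --safe #-}
-- Write Q_r(N,p;x) = (C_N(r) / D) Σ_u t_u with C_N(r) = [N r] - [N r-1] and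
-- D = q^(x²) [N-p x] [p x]. The recurrence already holds summand by summand: multiplied by
-- [p-x] [N-2r+1] q^r, the summand t_u of (N, p, r) is a fixed combination of the summands
-- of (N-1, p-1, r) and (N-1, p-1, r-1). This comes from the absorption identities for
-- q-binomials together with [a+m] [a+r] = [a+m+r] [a] + q^a [r] [m]; for u > p - r all three
-- summands vanish. The prefactors then match through [p x] [p-x] = [p-1 x] [p] and the closed
-- form C_N(r) [N-r+1] = q^r [N-2r+1] [N r].
module Submission where

open import Defs
open import Algebra.Bundles using (CommutativeMonoid; CommutativeRing)
open import Data.Bool.Properties using (if-cong; T-≡; T-∧)
open import Data.Empty using (⊥-elim)
open import Data.Integer as ℤ using (+_)
import Data.Integer.Properties as ℤP
open import Data.List using ([]; _∷_)
open import Data.Nat as ℕ using (ℕ; zero; suc; _≤_; _<_; z≤n; s≤s; _∸_; _⊓_)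
import Data.Nat.Coprimality as Coprime
open import Data.Nat.Primality using (prime⇒nonTrivial)
import Data.Nat.Properties as ℕP
import Data.Nat.Tactic.RingSolver as ℕ-Solver
open import Data.Product using (_×_; _,_)
open import Data.Rational as ℚ using (ℚ; 0ℚ; 1ℚ; _+_; _-_; _*_; mkℚ)
import Data.Rational.Properties as ℚP
open import Data.Sum using (_⊎_; inj₁; inj₂; [_,_]′)
open import Function using (_∘_)
open import Function.Bundles using (Equivalence)
open import Level using (0ℓ)
open import Relation.Binary.PropositionalEquality
open import Relation.Nullary using (yes; no)
open import Relation.Nullary.Decidable using (dec⇒maybe; toSum)
open import Tactic.RingSolver using (solve-∀; solve)
open import Tactic.RingSolver.Core.AlmostCommutativeRing
  using (AlmostCommutativeRing; fromCommutativeRing)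

open import Algebra.Properties.CommutativeSemigroup
  (CommutativeMonoid.commutativeSemigroup ℚP.*-1-commutativeMonoid) using (interchange)
open import Algebra.Properties.Ring (CommutativeRing.ring ℚP.+-*-commutativeRing)
  using (x[y-z]≈xy-xz)
open ≡-Reasoning

ℚ-ring : AlmostCommutativeRing 0ℓ 0ℓ
ℚ-ring = fromCommutativeRing ℚP.+-*-commutativeRing (λ x → dec⇒maybe (0ℚ ℚP.≟ x))

inv-inverseʳ : ∀ {a} → a ≢ 0ℚ → a * inv a ≡ 1ℚ
inv-inverseʳ {a} a≢0 with a ℚP.≟ 0ℚ
... | yes a≡0 = ⊥-elim (a≢0 a≡0)
... | no a≢0′ = ℚP.*-inverseʳ a {{ℚ.≢-nonZero a≢0′}}

*-cancelʳ : ∀ {a b c} → c ≢ 0ℚ → a * c ≡ b * c → a ≡ b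
*-cancelʳ {a} {b} {c} c≢0 ac≡bc = begin
  a                ≡⟨ sym (ℚP.*-identityʳ a) ⟩
  a * 1ℚ           ≡⟨ cong (a *_) (sym (inv-inverseʳ c≢0)) ⟩
  a * (c * inv c)  ≡⟨ sym (ℚP.*-assoc a c (inv c)) ⟩
  a * c * inv c    ≡⟨ cong (_* inv c) ac≡bc ⟩
  b * c * inv c    ≡⟨ ℚP.*-assoc b c (inv c) ⟩
  b * (c * inv c)  ≡⟨ cong (b *_) (inv-inverseʳ c≢0) ⟩
  b * 1ℚ           ≡⟨ ℚP.*-identityʳ b ⟩
  b                ∎

*-≢0 : ∀ {a b} → a ≢ 0ℚ → b ≢ 0ℚ → a * b ≢ 0ℚ
*-≢0 {a} {b} a≢0 b≢0 ab≡0 = a≢0 (*-cancelʳ b≢0 (trans ab≡0 (sym (ℚP.*-zeroˡ b))))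

inv-≢0 : ∀ {a} → a ≢ 0ℚ → inv a ≢ 0ℚ
inv-≢0 {a} a≢0 inva≡0 = ℚP.1≢0 (begin
  1ℚ          ≡⟨ sym (inv-inverseʳ a≢0) ⟩
  a * inv a   ≡⟨ cong (a *_) inva≡0 ⟩
  a * 0ℚ      ≡⟨ ℚP.*-zeroʳ a ⟩
  0ℚ          ∎)

inv-unique : ∀ a b → a * b ≡ 1ℚ → inv a ≡ b
inv-unique a b ab≡1 = *-cancelʳ a≢0 (begin
  inv a * a  ≡⟨ ℚP.*-comm (inv a) a ⟩
  a * inv a  ≡⟨ inv-inverseʳ a≢0 ⟩
  1ℚ         ≡⟨ sym ab≡1 ⟩
  a * b      ≡⟨ ℚP.*-comm a b ⟩
  b * a      ∎)
  where
  a≢0 : a ≢ 0ℚ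
  a≢0 refl = ℚP.1≢0 (trans (sym ab≡1) (ℚP.*-zeroˡ b))

inv-distrib-* : ∀ a b → inv (a * b) ≡ inv a * inv b
inv-distrib-* a b with toSum (a ℚP.≟ 0ℚ) | toSum (b ℚP.≟ 0ℚ)
... | inj₁ refl | _        = trans (cong inv (ℚP.*-zeroˡ b)) (sym (ℚP.*-zeroˡ (inv b)))
... | inj₂ _    | inj₁ refl = trans (cong inv (ℚP.*-zeroʳ a)) (sym (ℚP.*-zeroʳ (inv a)))
... | inj₂ a≢0  | inj₂ b≢0  = inv-unique (a * b) (inv a * inv b) (begin
  a * b * (inv a * inv b)  ≡⟨ interchange a b (inv a) (inv b) ⟩
  a * inv a * (b * inv b)  ≡⟨ cong₂ _*_ (inv-inverseʳ a≢0) (inv-inverseʳ b≢0) ⟩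
  1ℚ                       ∎)

inv-swap : ∀ a b {c d} → c ≢ 0ℚ → d ≢ 0ℚ → a * c ≡ b * d → inv a * d ≡ inv b * c
inv-swap a b {c} {d} c≢0 d≢0 ac≡bd =
  swap c d (inv a) (inv b) (inv c) (inv d) (inv-inverseʳ c≢0) (inv-inverseʳ d≢0)
    (trans (sym (inv-distrib-* a c)) (trans (cong inv ac≡bd) (inv-distrib-* b d)))
  where
  swap : ∀ c d a⁻¹ b⁻¹ c⁻¹ d⁻¹ → c * c⁻¹ ≡ 1ℚ → d * d⁻¹ ≡ 1ℚ →
         a⁻¹ * c⁻¹ ≡ b⁻¹ * d⁻¹ → a⁻¹ * d ≡ b⁻¹ * c
  swap c d a⁻¹ b⁻¹ c⁻¹ d⁻¹ cc⁻¹≡1 dd⁻¹≡1 h = begin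
    a⁻¹ * d                   ≡⟨ solve (a⁻¹ ∷ d ∷ []) ℚ-ring ⟩
    a⁻¹ * d * 1ℚ              ≡⟨ cong (a⁻¹ * d *_) (sym cc⁻¹≡1) ⟩
    a⁻¹ * d * (c * c⁻¹)       ≡⟨ solve (a⁻¹ ∷ d ∷ c ∷ c⁻¹ ∷ []) ℚ-ring ⟩
    a⁻¹ * c⁻¹ * (c * d)       ≡⟨ cong (_* (c * d)) h ⟩
    b⁻¹ * d⁻¹ * (c * d)       ≡⟨ solve (b⁻¹ ∷ d⁻¹ ∷ c ∷ d ∷ []) ℚ-ring ⟩
    b⁻¹ * c * (d * d⁻¹)       ≡⟨ cong (b⁻¹ * c *_) dd⁻¹≡1 ⟩
    b⁻¹ * c * 1ℚ              ≡⟨ solve (b⁻¹ ∷ c ∷ []) ℚ-ring ⟩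
    b⁻¹ * c                   ∎

÷-cancelˡ : ∀ c a b → c ≢ 0ℚ → (c * a) ÷ (c * b) ≡ a ÷ b
÷-cancelˡ c a b c≢0 = begin
  c * a * inv (c * b)        ≡⟨ cong (c * a *_) (inv-distrib-* c b) ⟩
  c * a * (inv c * inv b)    ≡⟨ interchange c a (inv c) (inv b) ⟩
  c * inv c * (a * inv b)    ≡⟨ cong (_* (a * inv b)) (inv-inverseʳ c≢0) ⟩
  1ℚ * (a * inv b)           ≡⟨ ℚP.*-identityˡ (a * inv b) ⟩
  a * inv b                  ∎

÷-*-÷-cancel : ∀ {a b} x → a ≢ 0ℚ → b ≢ 0ℚ → x ≡ a ÷ b * (b ÷ a * x)
÷-*-÷-cancel {a} {b} x a≢0 b≢0 = begin
  x                              ≡⟨ solve (x ∷ []) ℚ-ring ⟩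
  x * 1ℚ * 1ℚ                    ≡⟨ cong₂ (λ s t → x * s * t) (sym (inv-inverseʳ a≢0)) (sym (inv-inverseʳ b≢0)) ⟩
  x * (a * inv a) * (b * inv b)  ≡⟨ rearrange x a (inv a) b (inv b) ⟩
  a * inv b * (b * inv a * x)    ∎
  where
  rearrange : ∀ x a a⁻¹ b b⁻¹ → x * (a * a⁻¹) * (b * b⁻¹) ≡ a * b⁻¹ * (b * a⁻¹ * x)
  rearrange = solve-∀ ℚ-ring

p≢q⇒p-q≢0 : ∀ {a b} → a ≢ b → a - b ≢ 0ℚ
p≢q⇒p-q≢0 {a} {b} a≢b a-b≡0 = a≢b (begin
  a            ≡⟨ solve (a ∷ b ∷ []) ℚ-ring ⟩
  a - b + b    ≡⟨ cong (_+ b) a-b≡0 ⟩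
  0ℚ + b       ≡⟨ ℚP.+-identityˡ b ⟩
  b            ∎)

recombine₁ : ∀ {a s s₁ k k₁ b₁} → k ≢ 0ℚ → k * s ≡ k₁ * s₁ → a * k₁ ≡ b₁ * k → a * s ≡ b₁ * s₁
recombine₁ {a} {s} {s₁} {k} {k₁} {b₁} k≢0 hs h₁ = *-cancelʳ k≢0 (begin
  a * s * k      ≡⟨ solve (a ∷ s ∷ k ∷ []) ℚ-ring ⟩
  a * (k * s)    ≡⟨ cong (a *_) hs ⟩
  a * (k₁ * s₁)  ≡⟨ solve (a ∷ k₁ ∷ s₁ ∷ []) ℚ-ring ⟩
  a * k₁ * s₁    ≡⟨ cong (_* s₁) h₁ ⟩
  b₁ * k * s₁    ≡⟨ solve (b₁ ∷ k ∷ s₁ ∷ []) ℚ-ring ⟩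
  b₁ * s₁ * k    ∎)

recombine : ∀ {a s s₁ s₂ k k₁ k₂ b₁ b₂} → k ≢ 0ℚ →
  k * s ≡ k₁ * s₁ + k₂ * s₂ → a * k₁ ≡ b₁ * k → a * k₂ ≡ b₂ * k → a * s ≡ b₁ * s₁ + b₂ * s₂
recombine {a} {s} {s₁} {s₂} {k} {k₁} {k₂} {b₁} {b₂} k≢0 hs h₁ h₂ = *-cancelʳ k≢0 (begin
  a * s * k                  ≡⟨ solve (a ∷ s ∷ k ∷ []) ℚ-ring ⟩
  a * (k * s)                ≡⟨ cong (a *_) hs ⟩
  a * (k₁ * s₁ + k₂ * s₂)    ≡⟨ solve (a ∷ k₁ ∷ s₁ ∷ k₂ ∷ s₂ ∷ []) ℚ-ring ⟩
  a * k₁ * s₁ + a * k₂ * s₂  ≡⟨ cong₂ (λ y z → y * s₁ + z * s₂) h₁ h₂ ⟩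
  b₁ * k * s₁ + b₂ * k * s₂  ≡⟨ solve (b₁ ∷ k ∷ s₁ ∷ b₂ ∷ s₂ ∷ []) ℚ-ring ⟩
  (b₁ * s₁ + b₂ * s₂) * k    ∎)

coefficient-transfer : ∀ C̃ C D̃⁻¹ D⁻¹ K P P⁻¹ kx m KN c →
  P * P⁻¹ ≡ 1ℚ → D̃⁻¹ * P ≡ D⁻¹ * kx → C̃ * K ≡ KN * c * C * m →
  C̃ * D̃⁻¹ * K ≡ KN * P⁻¹ * c * (C * D⁻¹) * (kx * m)
coefficient-transfer C̃ C D̃⁻¹ D⁻¹ K P P⁻¹ kx m KN c hP hD hC = begin
  C̃ * D̃⁻¹ * K                           ≡⟨ solve (C̃ ∷ D̃⁻¹ ∷ K ∷ []) ℚ-ring ⟩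
  D̃⁻¹ * (C̃ * K) * 1ℚ                    ≡⟨ cong₂ (λ y z → D̃⁻¹ * y * z) hC (sym hP) ⟩
  D̃⁻¹ * (KN * c * C * m) * (P * P⁻¹)    ≡⟨ solve (D̃⁻¹ ∷ KN ∷ c ∷ C ∷ m ∷ P ∷ P⁻¹ ∷ []) ℚ-ring ⟩
  KN * P⁻¹ * c * C * m * (D̃⁻¹ * P)      ≡⟨ cong (KN * P⁻¹ * c * C * m *_) hD ⟩
  KN * P⁻¹ * c * C * m * (D⁻¹ * kx)     ≡⟨ solve (KN ∷ P⁻¹ ∷ c ∷ C ∷ m ∷ D⁻¹ ∷ kx ∷ []) ℚ-ring ⟩
  KN * P⁻¹ * c * (C * D⁻¹) * (kx * m)   ∎

suc[m]∸n≡m∸n+1 : ∀ {m n} → n ≤ m → suc m ∸ n ≡ m ∸ n ℕ.+ 1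
suc[m]∸n≡m∸n+1 {m} {n} n≤m = trans (ℕP.+-∸-assoc 1 n≤m) (ℕP.+-comm 1 (m ∸ n))

m≡n+o⇒m∸o≡n : ∀ {m n o} → m ≡ n ℕ.+ o → m ∸ o ≡ n
m≡n+o⇒m∸o≡n {n = n} {o} refl = ℕP.m+n∸n≡m n o

m≤n⇒m≤o⇒2*m≤n+o : ∀ {m n o} → m ≤ n → m ≤ o → 2 ℕ.* m ≤ n ℕ.+ o
m≤n⇒m≤o⇒2*m≤n+o {m} {n} {o} m≤n m≤o =
  subst (_≤ n ℕ.+ o) (cong (m ℕ.+_) (sym (ℕP.+-identityʳ m))) (ℕP.+-mono-≤ m≤n m≤o)

k<n∸m⇒m≤n : ∀ {k n} m → k < n ∸ m → m ≤ n
k<n∸m⇒m≤n m k<n∸m = ℕP.<⇒≤ (ℕP.m∸n≢0⇒n<m (ℕP.>⇒≢ (ℕP.≤-<-trans z≤n k<n∸m)))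

ι≡mkℚ : ∀ n → ι n ≡ mkℚ (+ n) 0 (Coprime.sym (Coprime.1-coprimeTo n))
ι≡mkℚ n = ℚP.normalize-coprime (Coprime.sym (Coprime.1-coprimeTo n))

ι-injective : ∀ {m n} → ι m ≡ ι n → m ≡ n
ι-injective {m} {n} ιm≡ιn = ℤP.+-injective (cong ℚ.↥_ (trans (sym (ι≡mkℚ m)) (trans ιm≡ιn (ι≡mkℚ n))))

ι-* : ∀ m n → ι (m ℕ.* n) ≡ ι m * ι n
ι-* m n = begin
  ι (m ℕ.* n)                    ≡⟨ cong (ℚ._/ 1) (ℤP.pos-* m n) ⟩
  (+ m ℤ.* + n) ℚ./ 1            ≡⟨ sym (cong₂ _*_ (ι≡mkℚ m) (ι≡mkℚ n)) ⟩
  ι m * ι n                      ∎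

ι-≢0 : ∀ {n} → 0 < n → ι n ≢ 0ℚ
ι-≢0 0<n ιn≡0 = ℕP.<⇒≢ 0<n (sym (ι-injective ιn≡0))

qpow-+ : ∀ q m n → qpow q (m ℕ.+ n) ≡ qpow q m * qpow q n
qpow-+ q m n = trans (cong ι (ℕP.^-distribˡ-+-* q m n)) (ι-* (q ℕ.^ m) (q ℕ.^ n))

qpow-suc : ∀ q n → qpow q (suc n) ≡ ι q * qpow q n
qpow-suc q n = ι-* q (q ℕ.^ n)

qpow-split : ∀ q {m n} → m ≤ n → qpow q n ≡ qpow q m * qpow q (n ∸ m)
qpow-split q {m} {n} m≤n = trans (cong (qpow q) (sym (ℕP.m+[n∸m]≡n m≤n))) (qpow-+ q m (n ∸ m))

qpow-≢0 : ∀ {q} n → 0 < q → qpow q n ≢ 0ℚ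
qpow-≢0 {q} n 0<q = ι-≢0 (ℕP.m^n>0 q {{ℕ.>-nonZero 0<q}} n)

qpow-≢1 : ∀ {q} k → 1 < q → 0 < k → qpow q k ≢ 1ℚ
qpow-≢1 {q} k 1<q 0<k qᵏ≡1 = ℕP.<⇒≢ (ℕP.^-monoʳ-< q 1<q 0<k) (sym (ι-injective qᵏ≡1))

qint-≢0 : ∀ {q} k → 1 < q → 0 < k → qint q k ≢ 0ℚ
qint-≢0 {q} k 1<q 0<k = *-≢0 (p≢q⇒p-q≢0 (qpow-≢1 k 1<q 0<k)) (inv-≢0 (p≢q⇒p-q≢0 q≢1))
  where
  q≢1 : ι q ≢ 1ℚ
  q≢1 q≡1 = ℕP.<⇒≢ 1<q (sym (ι-injective q≡1))

qint-0 : ∀ q → qint q 0 ≡ 0ℚ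
qint-0 q = ℚP.*-zeroˡ (inv (ι q - 1ℚ))

qint-+ : ∀ q m n → qint q (m ℕ.+ n) ≡ qint q n + qpow q n * qint q m
qint-+ q m n = trans (cong (λ z → (z - 1ℚ) * w) (qpow-+ q m n)) (expand (qpow q m) (qpow q n) w)
  where
  w = inv (ι q - 1ℚ)
  expand : ∀ qᵐ qⁿ w → (qᵐ * qⁿ - 1ℚ) * w ≡ (qⁿ - 1ℚ) * w + qⁿ * ((qᵐ - 1ℚ) * w)
  expand = solve-∀ ℚ-ring

qint-+-cross : ∀ q a m r →
  qint q (a ℕ.+ m) * qint q (a ℕ.+ r) ≡ qint q (a ℕ.+ m ℕ.+ r) * qint q a + qpow q a * qint q r * qint q m
qint-+-cross q a m r = begin
  (qpow q (a ℕ.+ m) - 1ℚ) * w * ((qpow q (a ℕ.+ r) - 1ℚ) * w)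
    ≡⟨ cong₂ (λ x y → (x - 1ℚ) * w * ((y - 1ℚ) * w)) (qpow-+ q a m) (qpow-+ q a r) ⟩
  (A * M - 1ℚ) * w * ((A * R - 1ℚ) * w)
    ≡⟨ expand A M R w ⟩
  (A * M * R - 1ℚ) * w * ((A - 1ℚ) * w) + A * ((R - 1ℚ) * w) * ((M - 1ℚ) * w)
    ≡⟨ cong (λ x → (x - 1ℚ) * w * ((A - 1ℚ) * w) + A * ((R - 1ℚ) * w) * ((M - 1ℚ) * w))
         (sym (trans (qpow-+ q (a ℕ.+ m) r) (cong (_* R) (qpow-+ q a m)))) ⟩
  (qpow q (a ℕ.+ m ℕ.+ r) - 1ℚ) * w * ((A - 1ℚ) * w) + A * ((R - 1ℚ) * w) * ((M - 1ℚ) * w) ∎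
  where
  w = inv (ι q - 1ℚ)
  A = qpow q a
  M = qpow q m
  R = qpow q r
  expand : ∀ A M R w → (A * M - 1ℚ) * w * ((A * R - 1ℚ) * w)
         ≡ (A * M * R - 1ℚ) * w * ((A - 1ℚ) * w) + A * ((R - 1ℚ) * w) * ((M - 1ℚ) * w)
  expand = solve-∀ ℚ-ring

prodTo-cong : ∀ b {f g} → (∀ i → i < b → f i ≡ g i) → prodTo b f ≡ prodTo b g
prodTo-cong zero    f≗g = refl
prodTo-cong (suc b) f≗g = cong₂ _*_ (prodTo-cong b (λ i i<b → f≗g i (ℕP.m<n⇒m<1+n i<b))) (f≗g b ℕP.≤-refl)

prodTo-zero : ∀ {b} f {i} → i < b → f i ≡ 0ℚ → prodTo b f ≡ 0ℚ
prodTo-zero {suc b} f {i} i<1+b fi≡0 with ℕP.m≤n⇒m<n∨m≡n (ℕP.≤-pred i<1+b)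
... | inj₁ i<b  = trans (cong (_* f b) (prodTo-zero f i<b fi≡0)) (ℚP.*-zeroˡ (f b))
... | inj₂ refl = trans (cong (prodTo b f *_) fi≡0) (ℚP.*-zeroʳ (prodTo b f))

prodTo-sucˡ : ∀ b f → prodTo (suc b) f ≡ f 0 * prodTo b (f ∘ suc)
prodTo-sucˡ zero    f = ℚP.*-comm 1ℚ (f 0)
prodTo-sucˡ (suc b) f = trans (cong (_* f (suc b)) (prodTo-sucˡ b f)) (ℚP.*-assoc (f 0) _ _)

sumUpTo-cong : ∀ x {f g} → (∀ u → u ≤ x → f u ≡ g u) → sumUpTo x f ≡ sumUpTo x g
sumUpTo-cong zero    f≗g = f≗g 0 z≤n
sumUpTo-cong (suc x) f≗g = cong₂ _+_ (sumUpTo-cong x (λ u u≤x → f≗g u (ℕP.m≤n⇒m≤1+n u≤x))) (f≗g (suc x) ℕP.≤-refl)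

sumUpTo-*ˡ : ∀ x c f → c * sumUpTo x f ≡ sumUpTo x (λ u → c * f u)
sumUpTo-*ˡ zero    c f = refl
sumUpTo-*ˡ (suc x) c f = trans (ℚP.*-distribˡ-+ c (sumUpTo x f) (f (suc x))) (cong (_+ c * f (suc x)) (sumUpTo-*ˡ x c f))

sumUpTo-+ : ∀ x f g → sumUpTo x (λ u → f u + g u) ≡ sumUpTo x f + sumUpTo x g
sumUpTo-+ zero    f g = refl
sumUpTo-+ (suc x) f g = trans (cong (_+ (f (suc x) + g (suc x))) (sumUpTo-+ x f g))
                              (interchange+ (sumUpTo x f) (sumUpTo x g) (f (suc x)) (g (suc x)))
  where
  interchange+ : ∀ a b c d → a + b + (c + d) ≡ a + c + (b + d)
  interchange+ = solve-∀ ℚ-ring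

sumUpTo-combination : ∀ x k k₁ k₂ f g h → (∀ u → u ≤ x → k * f u ≡ k₁ * g u + k₂ * h u) →
  k * sumUpTo x f ≡ k₁ * sumUpTo x g + k₂ * sumUpTo x h
sumUpTo-combination x k k₁ k₂ f g h termwise = begin
  k * sumUpTo x f                                   ≡⟨ sumUpTo-*ˡ x k f ⟩
  sumUpTo x (λ u → k * f u)                         ≡⟨ sumUpTo-cong x termwise ⟩
  sumUpTo x (λ u → k₁ * g u + k₂ * h u)             ≡⟨ sumUpTo-+ x (λ u → k₁ * g u) (λ u → k₂ * h u) ⟩
  sumUpTo x (λ u → k₁ * g u) + sumUpTo x (λ u → k₂ * h u)
    ≡⟨ sym (cong₂ _+_ (sumUpTo-*ˡ x k₁ g) (sumUpTo-*ˡ x k₂ h)) ⟩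
  k₁ * sumUpTo x g + k₂ * sumUpTo x h               ∎

qbin-zero : ∀ q {a b} → a < b → qbin q a (+ b) ≡ 0ℚ
qbin-zero q {a} {b} a<b = prodTo-zero (λ i → (qpow q a - qpow q i) ÷ (qpow q b - qpow q i)) a<b
  (trans (cong (_* d) (ℚP.+-inverseʳ (qpow q a))) (ℚP.*-zeroˡ d))
  where
  d : ℚ
  d = inv (qpow q b - qpow q a)

qbin-absorb : ∀ {q} a b → 1 < q → qbin q (suc a) (+ suc b) * qint q (suc b) ≡ qbin q a (+ b) * qint q (suc a)
qbin-absorb {q} a b 1<q = begin
  qbin q (suc a) (+ suc b) * qint q (suc b)
    ≡⟨ cong (_* qint q (suc b)) (trans (prodTo-sucˡ b f) (cong (f 0 *_) (prodTo-cong b (λ i _ → f-suc i)))) ⟩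
  (Qa - 1ℚ) * inv (Qb - 1ℚ) * B * ((Qb - 1ℚ) * w)
    ≡⟨ rearrange (Qa - 1ℚ) (Qb - 1ℚ) (inv (Qb - 1ℚ)) B w ⟩
  B * ((Qa - 1ℚ) * w) * ((Qb - 1ℚ) * inv (Qb - 1ℚ))
    ≡⟨ cong (B * qint q (suc a) *_) (inv-inverseʳ (p≢q⇒p-q≢0 Qb≢1)) ⟩
  B * qint q (suc a) * 1ℚ
    ≡⟨ ℚP.*-identityʳ _ ⟩
  B * qint q (suc a) ∎
  where
  Qa = qpow q (suc a)
  Qb = qpow q (suc b)
  B = qbin q a (+ b)
  w = inv (ι q - 1ℚ)
  f : ℕ → ℚ
  f i = (Qa - qpow q i) ÷ (Qb - qpow q i)
  f-suc : ∀ i → f (suc i) ≡ (qpow q a - qpow q i) ÷ (qpow q b - qpow q i)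
  f-suc i = begin
    (Qa - qpow q (suc i)) * inv (Qb - qpow q (suc i))
      ≡⟨ cong₂ (λ x y → x * inv y) (factor a) (factor b) ⟩
    (ι q * (qpow q a - qpow q i)) ÷ (ι q * (qpow q b - qpow q i))
      ≡⟨ ÷-cancelˡ (ι q) (qpow q a - qpow q i) (qpow q b - qpow q i) (ι-≢0 (ℕP.<-trans (s≤s z≤n) 1<q)) ⟩
    (qpow q a - qpow q i) ÷ (qpow q b - qpow q i) ∎
    where
    factor : ∀ n → qpow q (suc n) - qpow q (suc i) ≡ ι q * (qpow q n - qpow q i)
    factor n = trans (cong₂ _-_ (qpow-suc q n) (qpow-suc q i)) (sym (x[y-z]≈xy-xz (ι q) (qpow q n) (qpow q i)))
  Qb≢1 : Qb ≢ 1ℚ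
  Qb≢1 = qpow-≢1 (suc b) 1<q (s≤s z≤n)
  rearrange : ∀ x y y⁻¹ B w → x * y⁻¹ * B * (y * w) ≡ B * (x * w) * (y * y⁻¹)
  rearrange = solve-∀ ℚ-ring

-- The weights d are arbitrary so that the denominators of [c+1 u] and [c u] stay fixed
-- along the induction on u.
qfalling-suc : ∀ q c (d : ℕ → ℚ) u → u ≤ suc c →
  prodTo u (λ i → (qpow q (suc c) - qpow q i) * d i) * (qpow q (suc c ∸ u) - 1ℚ)
  ≡ prodTo u (λ i → (qpow q c - qpow q i) * d i) * (qpow q (suc c) - 1ℚ)
qfalling-suc q c d zero    _         = refl
qfalling-suc q c d (suc u) (s≤s u≤c) = begin
  P₁ * ((qpow q (suc c) - X) * d u) * (Y - 1ℚ)
    ≡⟨ cong (λ z → P₁ * ((z - X) * d u) * (Y - 1ℚ)) qᶜ⁺¹≡tXY ⟩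
  P₁ * ((ι q * (X * Y) - X) * d u) * (Y - 1ℚ)
    ≡⟨ shift P₁ P₀ (ι q) X Y (d u) IH ⟩
  P₀ * ((X * Y - X) * d u) * (ι q * (X * Y) - 1ℚ)
    ≡⟨ cong₂ (λ y z → P₀ * ((y - X) * d u) * (z - 1ℚ)) (sym qᶜ≡XY) (sym qᶜ⁺¹≡tXY) ⟩
  P₀ * ((qpow q c - X) * d u) * (qpow q (suc c) - 1ℚ) ∎
  where
  P₁ P₀ X Y : ℚ
  P₁ = prodTo u (λ i → (qpow q (suc c) - qpow q i) * d i)
  P₀ = prodTo u (λ i → (qpow q c - qpow q i) * d i)
  X = qpow q u
  Y = qpow q (c ∸ u)
  qᶜ≡XY : qpow q c ≡ X * Y
  qᶜ≡XY = qpow-split q u≤c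
  qᶜ⁺¹≡tXY : qpow q (suc c) ≡ ι q * (X * Y)
  qᶜ⁺¹≡tXY = trans (qpow-suc q c) (cong (ι q *_) qᶜ≡XY)
  IH : P₁ * (ι q * Y - 1ℚ) ≡ P₀ * (ι q * (X * Y) - 1ℚ)
  IH = subst₂ (λ y z → P₁ * (y - 1ℚ) ≡ P₀ * (z - 1ℚ))
         (trans (cong (qpow q) (ℕP.+-∸-assoc 1 u≤c)) (qpow-suc q (c ∸ u))) qᶜ⁺¹≡tXY
         (qfalling-suc q c d u (ℕP.m≤n⇒m≤1+n u≤c))
  shift : ∀ P₁ P₀ t X Y e → P₁ * (t * Y - 1ℚ) ≡ P₀ * (t * (X * Y) - 1ℚ) →
          P₁ * ((t * (X * Y) - X) * e) * (Y - 1ℚ) ≡ P₀ * ((X * Y - X) * e) * (t * (X * Y) - 1ℚ)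
  shift P₁ P₀ t X Y e h = begin
    P₁ * ((t * (X * Y) - X) * e) * (Y - 1ℚ)    ≡⟨ solve (P₁ ∷ t ∷ X ∷ Y ∷ e ∷ []) ℚ-ring ⟩
    P₁ * (t * Y - 1ℚ) * (X * e * (Y - 1ℚ))       ≡⟨ cong (_* (X * e * (Y - 1ℚ))) h ⟩
    P₀ * (t * (X * Y) - 1ℚ) * (X * e * (Y - 1ℚ)) ≡⟨ solve (P₀ ∷ t ∷ X ∷ Y ∷ e ∷ []) ℚ-ring ⟩
    P₀ * ((X * Y - X) * e) * (t * (X * Y) - 1ℚ)  ∎

qbin-absorb∸ : ∀ {q} a u → u ≤ a → qbin q a (+ u) * qint q (a ∸ u) ≡ qbin q (a ∸ 1) (+ u) * qint q a
qbin-absorb∸ zero    .zero z≤n    = refl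
qbin-absorb∸ {q} (suc c) u u≤1+c = begin
  qbin q (suc c) (+ u) * ((qpow q (suc c ∸ u) - 1ℚ) * w)  ≡⟨ sym (ℚP.*-assoc (qbin q (suc c) (+ u)) _ w) ⟩
  qbin q (suc c) (+ u) * (qpow q (suc c ∸ u) - 1ℚ) * w    ≡⟨ cong (_* w) (qfalling-suc q c d u u≤1+c) ⟩
  qbin q c (+ u) * (qpow q (suc c) - 1ℚ) * w              ≡⟨ ℚP.*-assoc (qbin q c (+ u)) _ w ⟩
  qbin q c (+ u) * ((qpow q (suc c) - 1ℚ) * w)            ∎
  where
  w : ℚ
  w = inv (ι q - 1ℚ)
  d : ℕ → ℚ
  d i = inv (qpow q u - qpow q i)

qbin-absorb-suc∸ : ∀ {q} p u x → 1 < q → u ≤ p → x ≤ p →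
  qbin q (suc p ∸ u) (+ (suc p ∸ x)) * qint q (suc p ∸ x) ≡ qbin q (p ∸ u) (+ (p ∸ x)) * qint q (suc p ∸ u)
qbin-absorb-suc∸ {q} p u x 1<q u≤p x≤p =
  subst₂ (λ i j → qbin q i (+ j) * qint q j ≡ qbin q (p ∸ u) (+ (p ∸ x)) * qint q i)
         (sym (ℕP.+-∸-assoc 1 u≤p)) (sym (ℕP.+-∸-assoc 1 x≤p)) (qbin-absorb (p ∸ u) (p ∸ x) 1<q)

qbin-sucʳ : ∀ {q} N r → 1 < q → r < N → qbin q N (+ r) * qint q (N ∸ r) ≡ qbin q N (+ suc r) * qint q (suc r)
qbin-sucʳ (suc N) r 1<q (s≤s r≤N) = trans (qbin-absorb∸ (suc N) r (ℕP.m≤n⇒m≤1+n r≤N)) (sym (qbin-absorb N r 1<q))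

qbinDiff : ℕ → ℕ → ℕ → ℚ
qbinDiff q N r = qbin q N (+ r) - qbin q N (+ r ℤ.- ℤ.1ℤ)

qbinDiff-closed : ∀ {q} N r → 1 < q → 2 ℕ.* r ≤ N →
  qbinDiff q N r * qint q (N ∸ r ℕ.+ 1) ≡ qpow q r * qint q (N ∸ 2 ℕ.* r ℕ.+ 1) * qbin q N (+ r)
qbinDiff-closed N zero    _   _    = sym (ℚP.*-identityʳ _)
qbinDiff-closed {q} N (suc r) 1<q 2r≤N = begin
  (B - B′) * qint q (N ∸ suc r ℕ.+ 1) ≡⟨ cong (λ k → (B - B′) * qint q k) N∸r≡ ⟩
  (B - B′) * qint q (N ∸ r)           ≡⟨ closed B B′ (qint q (N ∸ r)) (qint q (suc r)) (qpow q (suc r)) (qint q m)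
                                           (qbin-sucʳ N r 1<q r<N)
                                           (trans (cong (qint q) N∸r≡m+r) (qint-+ q m (suc r))) ⟩
  qpow q (suc r) * qint q m * B       ∎
  where
  B B′ : ℚ
  B = qbin q N (+ suc r)
  B′ = qbin q N (+ r)
  m : ℕ
  m = N ∸ 2 ℕ.* suc r ℕ.+ 1
  r<N : r < N
  r<N = ℕP.≤-trans (ℕP.m≤m+n (suc r) _) 2r≤N
  N∸r≡ : N ∸ suc r ℕ.+ 1 ≡ N ∸ r
  N∸r≡ = sym (suc[m]∸n≡m∸n+1 r<N)
  N∸r≡m+r : N ∸ r ≡ m ℕ.+ suc r
  N∸r≡m+r = m≡n+o⇒m∸o≡n (trans (sym (ℕP.m∸n+n≡m 2r≤N)) (regroup (N ∸ 2 ℕ.* suc r) r))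
    where
    regroup : ∀ M r → M ℕ.+ 2 ℕ.* suc r ≡ M ℕ.+ 1 ℕ.+ suc r ℕ.+ r
    regroup = ℕ-Solver.solve-∀
  closed : ∀ B B′ k kᵣ R kₘ → B′ * k ≡ B * kᵣ → k ≡ kᵣ + R * kₘ → (B - B′) * k ≡ R * kₘ * B
  closed B B′ k kᵣ R kₘ hB hk = begin
    (B - B′) * k            ≡⟨ solve (B ∷ B′ ∷ k ∷ []) ℚ-ring ⟩
    B * k - B′ * k          ≡⟨ cong₂ (λ x y → B * x - y) hk hB ⟩
    B * (kᵣ + R * kₘ) - B * kᵣ ≡⟨ solve (B ∷ kᵣ ∷ R ∷ kₘ ∷ []) ℚ-ring ⟩
    R * kₘ * B              ∎

qbinDiff-suc : ∀ {q} N r → 1 < q → 2 ℕ.* r ≤ N →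
  qbinDiff q (suc N) r * qint q (suc N ∸ r ℕ.+ 1) * qint q (suc N ∸ 2 ℕ.* r)
  ≡ qint q (suc N) * qbinDiff q N r * qint q (suc N ∸ 2 ℕ.* r ℕ.+ 1)
qbinDiff-suc {q} N r 1<q 2r≤N = *-cancelʳ (qint-≢0 (N ∸ r ℕ.+ 1) 1<q (ℕP.m≤n+m 1 (N ∸ r)))
  (regroup (qbinDiff q (suc N) r) (qbinDiff q N r) (qint q (N ∸ r ℕ.+ 1))
           (qint q (suc N ∸ r ℕ.+ 1)) (qint q (suc N ∸ 2 ℕ.* r)) (qint q (suc N ∸ 2 ℕ.* r ℕ.+ 1))
           (qint q (suc N)) (qpow q r) (qbin q (suc N) (+ r)) (qbin q N (+ r))
     (qbinDiff-closed (suc N) r 1<q (ℕP.m≤n⇒m≤1+n 2r≤N))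
     (trans (qbinDiff-closed N r 1<q 2r≤N) (cong (λ n → qpow q r * qint q n * qbin q N (+ r)) (sym (suc[m]∸n≡m∸n+1 2r≤N))))
     (trans (cong (λ n → qbin q (suc N) (+ r) * qint q n) (sym (suc[m]∸n≡m∸n+1 r≤N)))
            (qbin-absorb∸ (suc N) r (ℕP.m≤n⇒m≤1+n r≤N))))
  where
  r≤N : r ≤ N
  r≤N = ℕP.≤-trans (ℕP.m≤m+n r _) 2r≤N
  regroup : ∀ C̃ C k k₁ k₂ k₃ KN R B̃ B → C̃ * k₁ ≡ R * k₃ * B̃ → C * k ≡ R * k₂ * B → B̃ * k ≡ B * KN →
            C̃ * k₁ * k₂ * k ≡ KN * C * k₃ * k
  regroup C̃ C k k₁ k₂ k₃ KN R B̃ B hC̃ hC hB = begin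
    C̃ * k₁ * k₂ * k         ≡⟨ cong (λ x → x * k₂ * k) hC̃ ⟩
    R * k₃ * B̃ * k₂ * k     ≡⟨ solve (R ∷ k₃ ∷ B̃ ∷ k₂ ∷ k ∷ []) ℚ-ring ⟩
    R * k₃ * k₂ * (B̃ * k)   ≡⟨ cong (R * k₃ * k₂ *_) hB ⟩
    R * k₃ * k₂ * (B * KN)  ≡⟨ solve (R ∷ k₃ ∷ k₂ ∷ B ∷ KN ∷ []) ℚ-ring ⟩
    KN * k₃ * (R * k₂ * B)  ≡⟨ cong (KN * k₃ *_) (sym hC) ⟩
    KN * k₃ * (C * k)       ≡⟨ solve (KN ∷ k₃ ∷ C ∷ k ∷ []) ℚ-ring ⟩
    KN * C * k₃ * k         ∎

qbinDiff-suc-suc : ∀ {q} N r → 1 < q → 2 ℕ.* suc r ≤ suc N →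
  qbinDiff q (suc N) (suc r) * qint q (suc r) * qint q (suc N ∸ 2 ℕ.* suc r ℕ.+ 2)
  ≡ ι q * qint q (suc N) * qbinDiff q N r * qint q (suc N ∸ 2 ℕ.* suc r ℕ.+ 1)
qbinDiff-suc-suc {q} N r 1<q 2r≤N = *-cancelʳ (qint-≢0 (N ∸ r ℕ.+ 1) 1<q (ℕP.m≤n+m 1 (N ∸ r)))
  (regroup (qbinDiff q (suc N) (suc r)) (qbinDiff q N r) (qint q (N ∸ r ℕ.+ 1))
           (qint q (suc r)) (qint q (suc N ∸ 2 ℕ.* suc r ℕ.+ 2)) (qint q (suc N ∸ 2 ℕ.* suc r ℕ.+ 1))
           (qint q (suc N)) (ι q) (qpow q r) (qbin q (suc N) (+ suc r)) (qbin q N (+ r))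
     (trans (qbinDiff-closed (suc N) (suc r) 1<q 2r≤N)
            (cong (λ x → x * qint q (suc N ∸ 2 ℕ.* suc r ℕ.+ 1) * qbin q (suc N) (+ suc r)) (qpow-suc q r)))
     (trans (qbinDiff-closed N r 1<q 2r≤N′) (cong (λ n → qpow q r * qint q n * qbin q N (+ r)) N∸2r+1≡))
     (qbin-absorb N r 1<q))
  where
  2r≤N′ : 2 ℕ.* r ≤ N
  2r≤N′ = ℕP.≤-trans (ℕP.+-monoʳ-≤ r (ℕP.n≤1+n _)) (ℕP.≤-pred 2r≤N)
  N∸2r+1≡ : N ∸ 2 ℕ.* r ℕ.+ 1 ≡ suc N ∸ 2 ℕ.* suc r ℕ.+ 2
  N∸2r+1≡ = trans (cong (ℕ._+ 1) (m≡n+o⇒m∸o≡n N≡)) (ℕP.+-assoc (suc N ∸ 2 ℕ.* suc r) 1 1)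
    where
    N≡ : N ≡ suc N ∸ 2 ℕ.* suc r ℕ.+ 1 ℕ.+ 2 ℕ.* r
    N≡ = ℕP.suc-injective (trans (sym (ℕP.m∸n+n≡m 2r≤N)) (regroup (suc N ∸ 2 ℕ.* suc r) r))
      where
      regroup : ∀ M r → M ℕ.+ 2 ℕ.* suc r ≡ suc (M ℕ.+ 1 ℕ.+ 2 ℕ.* r)
      regroup = ℕ-Solver.solve-∀
  regroup : ∀ C̃ C k kᵣ k₂ k₃ KN t R B̃ B → C̃ * k ≡ t * R * k₃ * B̃ → C * k ≡ R * k₂ * B → B̃ * kᵣ ≡ B * KN →
            C̃ * kᵣ * k₂ * k ≡ t * KN * C * k₃ * k
  regroup C̃ C k kᵣ k₂ k₃ KN t R B̃ B hC̃ hC hB = begin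
    C̃ * kᵣ * k₂ * k           ≡⟨ solve (C̃ ∷ kᵣ ∷ k₂ ∷ k ∷ []) ℚ-ring ⟩
    C̃ * k * kᵣ * k₂           ≡⟨ cong (λ x → x * kᵣ * k₂) hC̃ ⟩
    t * R * k₃ * B̃ * kᵣ * k₂  ≡⟨ solve (t ∷ R ∷ k₃ ∷ B̃ ∷ kᵣ ∷ k₂ ∷ []) ℚ-ring ⟩
    t * k₃ * R * k₂ * (B̃ * kᵣ) ≡⟨ cong (t * k₃ * R * k₂ *_) hB ⟩
    t * k₃ * R * k₂ * (B * KN) ≡⟨ solve (t ∷ k₃ ∷ R ∷ k₂ ∷ B ∷ KN ∷ []) ℚ-ring ⟩
    t * KN * k₃ * (R * k₂ * B) ≡⟨ cong (t * KN * k₃ *_) (sym hC) ⟩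
    t * KN * k₃ * (C * k)      ≡⟨ solve (t ∷ KN ∷ k₃ ∷ C ∷ k ∷ []) ℚ-ring ⟩
    t * KN * C * k₃ * k        ∎

hahnDenom : (q N p x : ℕ) → ℚ
hahnDenom q N p x = qpow q (x ℕ.* x) * qbin q (N ∸ p) (+ x) * qbin q p (+ x)

hahnDenom-step : ∀ {q} N p x → 1 < q → x ≤ p →
  inv (hahnDenom q (suc N) (suc p) x) * qint q (suc p) ≡ inv (hahnDenom q N p x) * qint q (suc p ∸ x)
hahnDenom-step {q} N p x 1<q x≤p =
  inv-swap (hahnDenom q (suc N) (suc p) x) (hahnDenom q N p x) 
    (qint-≢0 (suc p ∸ x) 1<q (ℕP.m<n⇒0<n∸m (s≤s x≤p))) (qint-≢0 (suc p) 1<q (s≤s z≤n)) (begin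
    E * qbin q (suc p) (+ x) * qint q (suc p ∸ x)    ≡⟨ ℚP.*-assoc E _ _ ⟩
    E * (qbin q (suc p) (+ x) * qint q (suc p ∸ x))  ≡⟨ cong (E *_) (qbin-absorb∸ (suc p) x (ℕP.m≤n⇒m≤1+n x≤p)) ⟩
    E * (qbin q p (+ x) * qint q (suc p))            ≡⟨ sym (ℚP.*-assoc E _ _) ⟩
    E * qbin q p (+ x) * qint q (suc p)              ∎)
  where
  E : ℚ
  E = qpow q (x ℕ.* x) * qbin q (N ∸ p) (+ x)

hahnTerm : (q N p r x u : ℕ) → ℚ
hahnTerm q N p r x u =
  sign (x ∸ u) * qpow q (u ℕ.* r ℕ.+ choose2 (x ∸ u))
  * qbin q (p ∸ u) (+ (p ∸ x)) * qbin q (p ∸ r) (+ u) * qbin q (N ∸ p ℕ.+ u ∸ r) (+ u)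

hahnSum : (q N p r x : ℕ) → ℚ
hahnSum q N p r x = sumUpTo x (hahnTerm q N p r x)

hahnTerm-vanishes : ∀ q N p r x u → p ∸ r < u → hahnTerm q N p r x u ≡ 0ℚ
hahnTerm-vanishes q N p r x u p∸r<u = begin
  s * β * γ   ≡⟨ cong (λ z → s * z * γ) (qbin-zero q p∸r<u) ⟩
  s * 0ℚ * γ  ≡⟨ cong (_* γ) (ℚP.*-zeroʳ s) ⟩
  0ℚ * γ      ≡⟨ ℚP.*-zeroˡ γ ⟩
  0ℚ          ∎
  where
  s β γ : ℚ
  s = sign (x ∸ u) * qpow q (u ℕ.* r ℕ.+ choose2 (x ∸ u)) * qbin q (p ∸ u) (+ (p ∸ x))
  β = qbin q (p ∸ r) (+ u)
  γ = qbin q (N ∸ p ℕ.+ u ∸ r) (+ u)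

termWeight₀ : (q N p r x : ℕ) → ℚ
termWeight₀ q N p r x = qint q (suc p ∸ x) * (qint q (suc N ∸ 2 ℕ.* suc r ℕ.+ 1) * qpow q (suc r))

termWeight₁ termWeight₂ : (q N p r : ℕ) → ℚ
termWeight₁ q N p r = qpow q (suc r) * qint q (p ∸ r) * qint q (suc N ∸ suc r ℕ.+ 1)
termWeight₂ q N p r = qpow q (suc p) * qint q (N ∸ p ∸ suc r ℕ.+ 1) * qint q (suc r)

qbinDiff-weight₁ : ∀ {q} N p r → 1 < q → r ≤ p → suc r ≤ N ∸ p →
  qbinDiff q (suc N) (suc r) * termWeight₁ q N p r
  ≡ qint q (suc N) * (qint q (p ∸ r) ÷ qint q (suc N ∸ 2 ℕ.* suc r)) * qbinDiff q N (suc r)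
    * (qint q (suc N ∸ 2 ℕ.* suc r ℕ.+ 1) * qpow q (suc r))
qbinDiff-weight₁ {q} N p r 1<q r≤p r<N∸p =
  scale (qbinDiff q (suc N) (suc r)) (qbinDiff q N (suc r)) (qint q (suc N ∸ suc r ℕ.+ 1))
        (qint q (suc N ∸ 2 ℕ.* suc r)) (inv (qint q (suc N ∸ 2 ℕ.* suc r))) (qint q (suc N ∸ 2 ℕ.* suc r ℕ.+ 1))
        (qint q (suc N)) (qpow q (suc r)) (qint q (p ∸ r))
        (cases (ℕP.m≤n⇒m<n∨m≡n r≤p))
  where
  cases : r < p ⊎ r ≡ p →
    qint q (p ∸ r) ≡ 0ℚ
    ⊎ (qint q (suc N ∸ 2 ℕ.* suc r) * inv (qint q (suc N ∸ 2 ℕ.* suc r)) ≡ 1ℚ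
       × qbinDiff q (suc N) (suc r) * qint q (suc N ∸ suc r ℕ.+ 1) * qint q (suc N ∸ 2 ℕ.* suc r)
         ≡ qint q (suc N) * qbinDiff q N (suc r) * qint q (suc N ∸ 2 ℕ.* suc r ℕ.+ 1))
  cases (inj₁ r<p) = inj₂ (inv-inverseʳ (qint-≢0 _ 1<q (ℕP.m<n⇒0<n∸m (s≤s 2r≤N))) , qbinDiff-suc N (suc r) 1<q 2r≤N)
    where
    2r≤N : 2 ℕ.* suc r ≤ N
    2r≤N = ℕP.≤-trans (m≤n⇒m≤o⇒2*m≤n+o r<p r<N∸p) (ℕP.≤-reflexive (ℕP.m+[n∸m]≡n (k<n∸m⇒m≤n p r<N∸p)))
  cases (inj₂ r≡p) = inj₁ (trans (cong (λ i → qint q (p ∸ i)) r≡p) (trans (cong (qint q) (ℕP.n∸n≡0 p)) (qint-0 q)))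
  scale : ∀ C̃ C kN k₂ k₂⁻¹ k₃ KN R A →
    A ≡ 0ℚ ⊎ (k₂ * k₂⁻¹ ≡ 1ℚ × C̃ * kN * k₂ ≡ KN * C * k₃) →
    C̃ * (R * A * kN) ≡ KN * (A * k₂⁻¹) * C * (k₃ * R)
  scale C̃ C kN k₂ k₂⁻¹ k₃ KN R A (inj₁ refl) = solve (C̃ ∷ C ∷ kN ∷ k₂⁻¹ ∷ k₃ ∷ KN ∷ R ∷ []) ℚ-ring
  scale C̃ C kN k₂ k₂⁻¹ k₃ KN R A (inj₂ (k₂k₂⁻¹≡1 , hE)) = begin
    C̃ * (R * A * kN)              ≡⟨ solve (C̃ ∷ R ∷ A ∷ kN ∷ []) ℚ-ring ⟩
    R * A * (C̃ * kN) * 1ℚ         ≡⟨ cong (R * A * (C̃ * kN) *_) (sym k₂k₂⁻¹≡1) ⟩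
    R * A * (C̃ * kN) * (k₂ * k₂⁻¹) ≡⟨ solve (R ∷ A ∷ C̃ ∷ kN ∷ k₂ ∷ k₂⁻¹ ∷ []) ℚ-ring ⟩
    R * A * k₂⁻¹ * (C̃ * kN * k₂)  ≡⟨ cong (R * A * k₂⁻¹ *_) hE ⟩
    R * A * k₂⁻¹ * (KN * C * k₃)  ≡⟨ solve (R ∷ A ∷ k₂⁻¹ ∷ KN ∷ C ∷ k₃ ∷ []) ℚ-ring ⟩
    KN * (A * k₂⁻¹) * C * (k₃ * R) ∎

qbinDiff-weight₂ : ∀ {q} N p r → 1 < q → r ≤ p → suc r ≤ N ∸ p →
  qbinDiff q (suc N) (suc r) * termWeight₂ q N p r
  ≡ qint q (suc N) * (qpow q (suc p ∸ suc r ℕ.+ 1) * (qint q (N ∸ p ∸ suc r ℕ.+ 1) ÷ qint q (suc N ∸ 2 ℕ.* suc r ℕ.+ 2)))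
    * qbinDiff q N r * (qint q (suc N ∸ 2 ℕ.* suc r ℕ.+ 1) * qpow q (suc r))
qbinDiff-weight₂ {q} N p r 1<q r≤p r<N∸p =
  scale (qbinDiff q (suc N) (suc r)) (qbinDiff q N r) (qint q (suc r))
        (qint q (suc N ∸ 2 ℕ.* suc r ℕ.+ 2)) (inv (qint q (suc N ∸ 2 ℕ.* suc r ℕ.+ 2)))
        (qint q (suc N ∸ 2 ℕ.* suc r ℕ.+ 1)) (qint q (suc N)) (ι q) (qpow q (suc r))
        (qpow q (p ∸ r ℕ.+ 1)) (qpow q (suc p)) (qint q (N ∸ p ∸ suc r ℕ.+ 1))
        (qbinDiff-suc-suc N r 1<q 2r≤N)
        (inv-inverseʳ (qint-≢0 (suc N ∸ 2 ℕ.* suc r ℕ.+ 2) 1<q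
                                (ℕP.≤-trans (s≤s z≤n) (ℕP.m≤n+m 2 (suc N ∸ 2 ℕ.* suc r)))))
        (trans (sym (qpow-+ q (p ∸ r ℕ.+ 1) (suc r))) (trans (cong (qpow q) p∸r+1+r≡) (qpow-suc q (suc p))))
  where
  2r≤N : 2 ℕ.* suc r ≤ suc N
  2r≤N = ℕP.≤-trans (m≤n⇒m≤o⇒2*m≤n+o (s≤s r≤p) r<N∸p)
           (ℕP.≤-reflexive (cong suc (ℕP.m+[n∸m]≡n (k<n∸m⇒m≤n p r<N∸p))))
  p∸r+1+r≡ : p ∸ r ℕ.+ 1 ℕ.+ suc r ≡ suc (suc p)
  p∸r+1+r≡ = trans (regroup (p ∸ r) r) (cong (suc ∘ suc) (ℕP.m∸n+n≡m r≤p))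
    where
    regroup : ∀ d r → d ℕ.+ 1 ℕ.+ suc r ≡ suc (suc (d ℕ.+ r))
    regroup = ℕ-Solver.solve-∀
  scale : ∀ C̃ C kr k₄ k₄⁻¹ k₃ KN t R T P B →
    C̃ * kr * k₄ ≡ t * KN * C * k₃ → k₄ * k₄⁻¹ ≡ 1ℚ → T * R ≡ t * P →
    C̃ * (P * B * kr) ≡ KN * (T * (B * k₄⁻¹)) * C * (k₃ * R)
  scale C̃ C kr k₄ k₄⁻¹ k₃ KN t R T P B hE k₄k₄⁻¹≡1 hT = begin
    C̃ * (P * B * kr)                   ≡⟨ solve (C̃ ∷ P ∷ B ∷ kr ∷ []) ℚ-ring ⟩
    P * B * (C̃ * kr) * 1ℚ              ≡⟨ cong (P * B * (C̃ * kr) *_) (sym k₄k₄⁻¹≡1) ⟩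
    P * B * (C̃ * kr) * (k₄ * k₄⁻¹)     ≡⟨ solve (P ∷ B ∷ C̃ ∷ kr ∷ k₄ ∷ k₄⁻¹ ∷ []) ℚ-ring ⟩
    P * B * k₄⁻¹ * (C̃ * kr * k₄)       ≡⟨ cong (P * B * k₄⁻¹ *_) hE ⟩
    P * B * k₄⁻¹ * (t * KN * C * k₃)   ≡⟨ solve (P ∷ B ∷ k₄⁻¹ ∷ t ∷ KN ∷ C ∷ k₃ ∷ []) ℚ-ring ⟩
    t * P * (B * k₄⁻¹ * KN * C * k₃)   ≡⟨ cong (_* (B * k₄⁻¹ * KN * C * k₃)) (sym hT) ⟩
    T * R * (B * k₄⁻¹ * KN * C * k₃)   ≡⟨ solve (T ∷ R ∷ B ∷ k₄⁻¹ ∷ KN ∷ C ∷ k₃ ∷ []) ℚ-ring ⟩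
    KN * (T * (B * k₄⁻¹)) * C * (k₃ * R) ∎

module HahnStepArithmetic {N p r u : ℕ} (r≤p : r ≤ p) (r<N∸p : suc r ≤ N ∸ p) (u≤p∸r : u ≤ p ∸ r) where
  n a b : ℕ
  n = N ∸ p
  a = p ∸ r ∸ u
  b = n ∸ suc r

  p≡ : p ≡ a ℕ.+ u ℕ.+ r
  p≡ = trans (sym (ℕP.m∸n+n≡m r≤p)) (cong (ℕ._+ r) (sym (ℕP.m∸n+n≡m u≤p∸r)))

  N≡ : N ≡ b ℕ.+ suc r ℕ.+ (a ℕ.+ u ℕ.+ r)
  N≡ = trans (sym (ℕP.m∸n+n≡m p≤N)) (cong₂ ℕ._+_ (sym (ℕP.m∸n+n≡m r<N∸p)) p≡)
    where
    p≤N : p ≤ N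
    p≤N = k<n∸m⇒m≤n p r<N∸p

  u≤p : u ≤ p
  u≤p = ℕP.≤-trans u≤p∸r (ℕP.m∸n≤m p r)

  1+p≡ : suc p ≡ a ℕ.+ suc r ℕ.+ u
  1+p≡ = trans (cong suc p≡) (regroup a u r)
    where
    regroup : ∀ a u r → suc (a ℕ.+ u ℕ.+ r) ≡ a ℕ.+ suc r ℕ.+ u
    regroup = ℕ-Solver.solve-∀

  1+p∸u≡ : suc p ∸ u ≡ a ℕ.+ suc r
  1+p∸u≡ = m≡n+o⇒m∸o≡n 1+p≡

  N∸2r+1≡ : suc N ∸ 2 ℕ.* suc r ℕ.+ 1 ≡ a ℕ.+ (b ℕ.+ u ℕ.+ 1)
  N∸2r+1≡ = trans (cong (ℕ._+ 1) (m≡n+o⇒m∸o≡n (trans (cong suc N≡) (regroup a b u r)))) (ℕP.+-assoc a (b ℕ.+ u) 1)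
    where
    regroup : ∀ a b u r → suc (b ℕ.+ suc r ℕ.+ (a ℕ.+ u ℕ.+ r)) ≡ a ℕ.+ (b ℕ.+ u) ℕ.+ 2 ℕ.* suc r
    regroup = ℕ-Solver.solve-∀

  N∸r+1≡ : suc N ∸ suc r ℕ.+ 1 ≡ a ℕ.+ (b ℕ.+ u ℕ.+ 1) ℕ.+ suc r
  N∸r+1≡ = trans (cong (ℕ._+ 1) (m≡n+o⇒m∸o≡n (trans N≡ (regroup a b u r)))) (regroup′ a b u r)
    where
    regroup : ∀ a b u r → b ℕ.+ suc r ℕ.+ (a ℕ.+ u ℕ.+ r) ≡ a ℕ.+ (b ℕ.+ u) ℕ.+ suc r ℕ.+ r
    regroup = ℕ-Solver.solve-∀
    regroup′ : ∀ a b u r → a ℕ.+ (b ℕ.+ u) ℕ.+ suc r ℕ.+ 1 ≡ a ℕ.+ (b ℕ.+ u ℕ.+ 1) ℕ.+ suc r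
    regroup′ = ℕ-Solver.solve-∀

  n+u∸r≡ : n ℕ.+ u ∸ r ≡ b ℕ.+ u ℕ.+ 1
  n+u∸r≡ = m≡n+o⇒m∸o≡n (trans (cong (ℕ._+ u) (sym (ℕP.m∸n+n≡m r<N∸p))) (regroup b u r))
    where
    regroup : ∀ b u r → b ℕ.+ suc r ℕ.+ u ≡ b ℕ.+ u ℕ.+ 1 ℕ.+ r
    regroup = ℕ-Solver.solve-∀

  n+u∸r∸u≡ : n ℕ.+ u ∸ r ∸ u ≡ n ∸ suc r ℕ.+ 1
  n+u∸r∸u≡ = m≡n+o⇒m∸o≡n (trans n+u∸r≡ (regroup b u))
    where
    regroup : ∀ b u → b ℕ.+ u ℕ.+ 1 ≡ b ℕ.+ 1 ℕ.+ u
    regroup = ℕ-Solver.solve-∀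

  n+u∸r∸1≡ : n ℕ.+ u ∸ r ∸ 1 ≡ n ℕ.+ u ∸ suc r
  n+u∸r∸1≡ = trans (ℕP.∸-+-assoc (n ℕ.+ u) r 1) (cong (n ℕ.+ u ∸_) (ℕP.+-comm r 1))

  u≤n+u∸r : u ≤ n ℕ.+ u ∸ r
  u≤n+u∸r = subst (u ≤_) (sym n+u∸r≡) (ℕP.≤-trans (ℕP.m≤n+m u b) (ℕP.m≤m+n (b ℕ.+ u) 1))

  p∸r∸1≡ : p ∸ r ∸ 1 ≡ p ∸ suc r
  p∸r∸1≡ = trans (ℕP.∸-+-assoc p r 1) (cong (p ∸_) (ℕP.+-comm r 1))

hahnTerm-step-vanishing : ∀ q N p r x u → p ∸ r < u →
  termWeight₀ q N p r x * hahnTerm q (suc N) (suc p) (suc r) x u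
  ≡ termWeight₁ q N p r * hahnTerm q N p (suc r) x u + termWeight₂ q N p r * hahnTerm q N p r x u
hahnTerm-step-vanishing q N p r x u p∸r<u = begin
  K₀ * hahnTerm q (suc N) (suc p) (suc r) x u
    ≡⟨ cong (K₀ *_) (hahnTerm-vanishes q (suc N) (suc p) (suc r) x u p∸r<u) ⟩
  K₀ * 0ℚ
    ≡⟨ ℚP.*-zeroʳ K₀ ⟩
  0ℚ
    ≡⟨ sym (cong₂ _+_ (ℚP.*-zeroʳ K₁) (ℚP.*-zeroʳ K₂)) ⟩
  K₁ * 0ℚ + K₂ * 0ℚ
    ≡⟨ cong₂ (λ y z → K₁ * y + K₂ * z) (hahnTerm-vanishes q N p (suc r) x u p∸1+r<u)
                                       (hahnTerm-vanishes q N p r x u p∸r<u) ⟨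
  K₁ * hahnTerm q N p (suc r) x u + K₂ * hahnTerm q N p r x u ∎
  where
  K₀ K₁ K₂ : ℚ
  K₀ = termWeight₀ q N p r x
  K₁ = termWeight₁ q N p r
  K₂ = termWeight₂ q N p r
  p∸1+r<u : p ∸ suc r < u
  p∸1+r<u = ℕP.≤-<-trans (ℕP.∸-monoʳ-≤ p (ℕP.n≤1+n r)) p∸r<u

hahnTerm-step-within : ∀ {q} N p r x u → 1 < q → r ≤ p → suc r ≤ N ∸ p → x ≤ p → u ≤ p ∸ r →
  termWeight₀ q N p r x * hahnTerm q (suc N) (suc p) (suc r) x u
  ≡ termWeight₁ q N p r * hahnTerm q N p (suc r) x u + termWeight₂ q N p r * hahnTerm q N p r x u
hahnTerm-step-within {q} N p r x u 1<q r≤p r<N∸p x≤p u≤p∸r = combine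
  (sign (x ∸ u)) (qpow q (u ℕ.* suc r ℕ.+ choose2 (x ∸ u))) (qpow q u) (qpow q (u ℕ.* r ℕ.+ choose2 (x ∸ u)))
  (qbin q (suc p ∸ u) (+ (suc p ∸ x))) (qbin q (p ∸ u) (+ (p ∸ x)))
  (qbin q (p ∸ r) (+ u)) (qbin q (p ∸ suc r) (+ u))
  (qbin q (n ℕ.+ u ∸ suc r) (+ u)) (qbin q (n ℕ.+ u ∸ r) (+ u))
  (qint q (suc p ∸ x)) (qint q (suc p ∸ u)) (qint q (p ∸ r ∸ u)) (qint q (p ∸ r))
  (qint q (suc N ∸ 2 ℕ.* suc r ℕ.+ 1)) (qint q (suc N ∸ suc r ℕ.+ 1))
  (qint q (n ∸ suc r ℕ.+ 1)) (qint q (n ℕ.+ u ∸ r)) (qint q (suc r))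
  (qpow q (suc r)) (qpow q (suc p)) (qpow q a)
  power-split (qbin-absorb-suc∸ p u x 1<q u≤p x≤p) hβ hγ cross 1+p-split
  where
  open HahnStepArithmetic r≤p r<N∸p u≤p∸r
  power-split : qpow q (u ℕ.* suc r ℕ.+ choose2 (x ∸ u)) ≡ qpow q u * qpow q (u ℕ.* r ℕ.+ choose2 (x ∸ u))
  power-split = trans (cong (qpow q) (trans (cong (ℕ._+ choose2 (x ∸ u)) (ℕP.*-suc u r)) (ℕP.+-assoc u (u ℕ.* r) _)))
                      (qpow-+ q u _)
  hβ : qbin q (p ∸ r) (+ u) * qint q (p ∸ r ∸ u) ≡ qbin q (p ∸ suc r) (+ u) * qint q (p ∸ r)
  hβ = subst (λ i → qbin q (p ∸ r) (+ u) * qint q (p ∸ r ∸ u) ≡ qbin q i (+ u) * qint q (p ∸ r))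
             p∸r∸1≡ (qbin-absorb∸ (p ∸ r) u u≤p∸r)
  hγ : qbin q (n ℕ.+ u ∸ r) (+ u) * qint q (n ∸ suc r ℕ.+ 1) ≡ qbin q (n ℕ.+ u ∸ suc r) (+ u) * qint q (n ℕ.+ u ∸ r)
  hγ = subst₂ (λ k i → qbin q (n ℕ.+ u ∸ r) (+ u) * qint q k ≡ qbin q i (+ u) * qint q (n ℕ.+ u ∸ r))
              n+u∸r∸u≡ n+u∸r∸1≡ (qbin-absorb∸ (n ℕ.+ u ∸ r) u u≤n+u∸r)
  cross : qint q (suc N ∸ 2 ℕ.* suc r ℕ.+ 1) * qint q (suc p ∸ u)
        ≡ qint q (suc N ∸ suc r ℕ.+ 1) * qint q (p ∸ r ∸ u) + qpow q a * qint q (suc r) * qint q (n ℕ.+ u ∸ r)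
  cross = begin
    qint q (suc N ∸ 2 ℕ.* suc r ℕ.+ 1) * qint q (suc p ∸ u)
      ≡⟨ cong₂ (λ i j → qint q i * qint q j) N∸2r+1≡ 1+p∸u≡ ⟩
    qint q (a ℕ.+ (b ℕ.+ u ℕ.+ 1)) * qint q (a ℕ.+ suc r)
      ≡⟨ qint-+-cross q a (b ℕ.+ u ℕ.+ 1) (suc r) ⟩
    qint q (a ℕ.+ (b ℕ.+ u ℕ.+ 1) ℕ.+ suc r) * qint q a + qpow q a * qint q (suc r) * qint q (b ℕ.+ u ℕ.+ 1)
      ≡⟨ cong₂ (λ i j → qint q i * qint q a + qpow q a * qint q (suc r) * qint q j) (sym N∸r+1≡) (sym n+u∸r≡) ⟩
    qint q (suc N ∸ suc r ℕ.+ 1) * qint q (p ∸ r ∸ u) + qpow q a * qint q (suc r) * qint q (n ℕ.+ u ∸ r) ∎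
  1+p-split : qpow q (suc p) ≡ qpow q a * qpow q (suc r) * qpow q u
  1+p-split = trans (cong (qpow q) 1+p≡) (trans (qpow-+ q (a ℕ.+ suc r) u) (cong (_* qpow q u) (qpow-+ q a (suc r))))
  combine : ∀ s W U V α α′ β β′ γ γ′ kx ku kru kpr k₂ kN kn kn′ kr R P Qa →
    W ≡ U * V → α * kx ≡ α′ * ku → β * kru ≡ β′ * kpr → γ′ * kn ≡ γ * kn′ →
    k₂ * ku ≡ kN * kru + Qa * kr * kn′ → P ≡ Qa * R * U →
    kx * (k₂ * R) * (s * W * α * β * γ) ≡ R * kpr * kN * (s * W * α′ * β′ * γ) + P * kn * kr * (s * V * α′ * β * γ′)
  combine s W U V α α′ β β′ γ γ′ kx ku kru kpr k₂ kN kn kn′ kr R P Qa refl hα hβ hγ hk refl = begin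
    kx * (k₂ * R) * (s * (U * V) * α * β * γ)
      ≡⟨ solve (kx ∷ k₂ ∷ R ∷ s ∷ U ∷ V ∷ α ∷ β ∷ γ ∷ []) ℚ-ring ⟩
    α * kx * (s * V * β * γ * (k₂ * (U * R)))
      ≡⟨ cong (λ z → z * (s * V * β * γ * (k₂ * (U * R)))) hα ⟩
    α′ * ku * (s * V * β * γ * (k₂ * (U * R)))
      ≡⟨ solve (α′ ∷ ku ∷ s ∷ V ∷ β ∷ γ ∷ k₂ ∷ U ∷ R ∷ []) ℚ-ring ⟩
    s * V * α′ * β * γ * (U * R) * (k₂ * ku)
      ≡⟨ cong (s * V * α′ * β * γ * (U * R) *_) hk ⟩
    s * V * α′ * β * γ * (U * R) * (kN * kru + Qa * kr * kn′)
      ≡⟨ solve (s ∷ V ∷ α′ ∷ β ∷ γ ∷ U ∷ R ∷ kN ∷ kru ∷ Qa ∷ kr ∷ kn′ ∷ []) ℚ-ring ⟩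
    R * kN * (s * (U * V) * α′ * γ) * (β * kru) + Qa * R * U * kr * (s * V * α′ * β) * (γ * kn′)
      ≡⟨ cong₂ (λ y z → R * kN * (s * (U * V) * α′ * γ) * y + Qa * R * U * kr * (s * V * α′ * β) * z) hβ (sym hγ) ⟩
    R * kN * (s * (U * V) * α′ * γ) * (β′ * kpr) + Qa * R * U * kr * (s * V * α′ * β) * (γ′ * kn)
      ≡⟨ solve (R ∷ kN ∷ s ∷ U ∷ V ∷ α′ ∷ γ ∷ β′ ∷ kpr ∷ Qa ∷ kr ∷ β ∷ γ′ ∷ kn ∷ []) ℚ-ring ⟩
    R * kpr * kN * (s * (U * V) * α′ * β′ * γ) + Qa * R * U * kn * kr * (s * V * α′ * β * γ′) ∎

hahnSum-step : ∀ {q} N p r x → 1 < q → r ≤ p → suc r ≤ N ∸ p → x ≤ p →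
  termWeight₀ q N p r x * hahnSum q (suc N) (suc p) (suc r) x
  ≡ termWeight₁ q N p r * hahnSum q N p (suc r) x + termWeight₂ q N p r * hahnSum q N p r x
hahnSum-step {q} N p r x 1<q r≤p r<N∸p x≤p = sumUpTo-combination x
  (termWeight₀ q N p r x) (termWeight₁ q N p r) (termWeight₂ q N p r)
  (hahnTerm q (suc N) (suc p) (suc r) x) (hahnTerm q N p (suc r) x) (hahnTerm q N p r x) termwise
  where
  termwise : ∀ u → u ≤ x →
    termWeight₀ q N p r x * hahnTerm q (suc N) (suc p) (suc r) x u
    ≡ termWeight₁ q N p r * hahnTerm q N p (suc r) x u + termWeight₂ q N p r * hahnTerm q N p r x u
  termwise u _ = [ hahnTerm-step-within N p r x u 1<q r≤p r<N∸p x≤p , hahnTerm-step-vanishing q N p r x u ]′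
                   (ℕP.≤-<-connex u (p ∸ r))

hahnTerm-step₀ : ∀ {q} N p x u → 1 < q → x ≤ p → u ≤ x →
  qint q (suc p ∸ x) * hahnTerm q (suc N) (suc p) 0 x u ≡ qint q (suc p) * hahnTerm q N p 0 x u
hahnTerm-step₀ {q} N p x u 1<q x≤p u≤x = combine
  (sign (x ∸ u) * qpow q (u ℕ.* 0 ℕ.+ choose2 (x ∸ u)))
  (qbin q (suc p ∸ u) (+ (suc p ∸ x))) (qbin q (p ∸ u) (+ (p ∸ x)))
  (qbin q (suc p) (+ u)) (qbin q p (+ u)) (qbin q (N ∸ p ℕ.+ u) (+ u))
  (qint q (suc p ∸ x)) (qint q (suc p ∸ u)) (qint q (suc p))
  (qbin-absorb-suc∸ p u x 1<q u≤p x≤p) (qbin-absorb∸ (suc p) u (ℕP.m≤n⇒m≤1+n u≤p))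
  where
  u≤p : u ≤ p
  u≤p = ℕP.≤-trans u≤x x≤p
  combine : ∀ s α α′ β β′ γ kx ku kp → α * kx ≡ α′ * ku → β * ku ≡ β′ * kp →
            kx * (s * α * β * γ) ≡ kp * (s * α′ * β′ * γ)
  combine s α α′ β β′ γ kx ku kp hα hβ = begin
    kx * (s * α * β * γ)   ≡⟨ solve (kx ∷ s ∷ α ∷ β ∷ γ ∷ []) ℚ-ring ⟩
    α * kx * (s * β * γ)   ≡⟨ cong (_* (s * β * γ)) hα ⟩
    α′ * ku * (s * β * γ)  ≡⟨ solve (α′ ∷ ku ∷ s ∷ β ∷ γ ∷ []) ℚ-ring ⟩
    β * ku * (s * α′ * γ)  ≡⟨ cong (_* (s * α′ * γ)) hβ ⟩
    β′ * kp * (s * α′ * γ) ≡⟨ solve (β′ ∷ kp ∷ s ∷ α′ ∷ γ ∷ []) ℚ-ring ⟩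
    kp * (s * α′ * β′ * γ) ∎

hahnSum-step₀ : ∀ {q} N p x → 1 < q → x ≤ p →
  qint q (suc p ∸ x) * hahnSum q (suc N) (suc p) 0 x ≡ qint q (suc p) * hahnSum q N p 0 x
hahnSum-step₀ {q} N p x 1<q x≤p = begin
  qint q (suc p ∸ x) * hahnSum q (suc N) (suc p) 0 x
    ≡⟨ sumUpTo-*ˡ x (qint q (suc p ∸ x)) (hahnTerm q (suc N) (suc p) 0 x) ⟩
  sumUpTo x (λ u → qint q (suc p ∸ x) * hahnTerm q (suc N) (suc p) 0 x u)
    ≡⟨ sumUpTo-cong x (λ u u≤x → hahnTerm-step₀ N p x u 1<q x≤p u≤x) ⟩
  sumUpTo x (λ u → qint q (suc p) * hahnTerm q N p 0 x u)
    ≡⟨ sym (sumUpTo-*ˡ x (qint q (suc p)) (hahnTerm q N p 0 x)) ⟩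
  qint q (suc p) * hahnSum q N p 0 x ∎

QHahnℕ-step : ∀ {q} N p r x → 1 < q → r ≤ p → suc r ≤ N ∸ p → x ≤ p →
  QHahnℕ q (suc N) (suc p) (suc r) x
  ≡ (qint q (suc N) ÷ qint q (suc p))
    * ((qint q (p ∸ r) ÷ qint q (suc N ∸ 2 ℕ.* suc r)) * QHahnℕ q N p (suc r) x
       + qpow q (suc p ∸ suc r ℕ.+ 1) * (qint q (N ∸ p ∸ suc r ℕ.+ 1) ÷ qint q (suc N ∸ 2 ℕ.* suc r ℕ.+ 2))
         * QHahnℕ q N p r x)
QHahnℕ-step {q} N p r x 1<q r≤p r<N∸p x≤p = begin
  C̃ * D̃⁻¹ * S̃
    ≡⟨ recombine {C̃ * D̃⁻¹} {S̃} {S₁} {S₂} {kx * m} {termWeight₁ q N p r} {termWeight₂ q N p r}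
         {KN * P⁻¹ * c₁ * (C₁ * D⁻¹)} {KN * P⁻¹ * c₂ * (C₂ * D⁻¹)}
         (*-≢0 kx≢0 m≢0) (hahnSum-step N p r x 1<q r≤p r<N∸p x≤p)
         (transfer (termWeight₁ q N p r) C₁ c₁ (qbinDiff-weight₁ N p r 1<q r≤p r<N∸p))
         (transfer (termWeight₂ q N p r) C₂ c₂ (qbinDiff-weight₂ N p r 1<q r≤p r<N∸p)) ⟩
  KN * P⁻¹ * c₁ * (C₁ * D⁻¹) * S₁ + KN * P⁻¹ * c₂ * (C₂ * D⁻¹) * S₂
    ≡⟨ factor KN P⁻¹ c₁ c₂ (C₁ * D⁻¹) (C₂ * D⁻¹) S₁ S₂ ⟩
  KN * P⁻¹ * (c₁ * (C₁ * D⁻¹ * S₁) + c₂ * (C₂ * D⁻¹ * S₂)) ∎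
  where
  C̃ C₁ C₂ D̃⁻¹ D⁻¹ S̃ S₁ S₂ KN P⁻¹ c₁ c₂ kx m : ℚ
  C̃ = qbinDiff q (suc N) (suc r)
  C₁ = qbinDiff q N (suc r)
  C₂ = qbinDiff q N r
  D̃⁻¹ = inv (hahnDenom q (suc N) (suc p) x)
  D⁻¹ = inv (hahnDenom q N p x)
  S̃ = hahnSum q (suc N) (suc p) (suc r) x
  S₁ = hahnSum q N p (suc r) x
  S₂ = hahnSum q N p r x
  KN = qint q (suc N)
  P⁻¹ = inv (qint q (suc p))
  c₁ = qint q (p ∸ r) ÷ qint q (suc N ∸ 2 ℕ.* suc r)
  c₂ = qpow q (suc p ∸ suc r ℕ.+ 1) * (qint q (N ∸ p ∸ suc r ℕ.+ 1) ÷ qint q (suc N ∸ 2 ℕ.* suc r ℕ.+ 2))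
  kx = qint q (suc p ∸ x)
  m = qint q (suc N ∸ 2 ℕ.* suc r ℕ.+ 1) * qpow q (suc r)
  kx≢0 : kx ≢ 0ℚ
  kx≢0 = qint-≢0 (suc p ∸ x) 1<q (ℕP.m<n⇒0<n∸m (s≤s x≤p))
  m≢0 : m ≢ 0ℚ
  m≢0 = *-≢0 (qint-≢0 (suc N ∸ 2 ℕ.* suc r ℕ.+ 1) 1<q (ℕP.m≤n+m 1 _)) (qpow-≢0 (suc r) (ℕP.<-trans (s≤s z≤n) 1<q))
  transfer : ∀ K C c → C̃ * K ≡ KN * c * C * m → C̃ * D̃⁻¹ * K ≡ KN * P⁻¹ * c * (C * D⁻¹) * (kx * m)
  transfer K C c = coefficient-transfer C̃ C D̃⁻¹ D⁻¹ K (qint q (suc p)) P⁻¹ kx m KN c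
    (inv-inverseʳ (qint-≢0 (suc p) 1<q (s≤s z≤n))) (hahnDenom-step N p x 1<q x≤p)
  factor : ∀ KN P⁻¹ c₁ c₂ a₁ a₂ S₁ S₂ →
    KN * P⁻¹ * c₁ * a₁ * S₁ + KN * P⁻¹ * c₂ * a₂ * S₂ ≡ KN * P⁻¹ * (c₁ * (a₁ * S₁) + c₂ * (a₂ * S₂))
  factor = solve-∀ ℚ-ring

QHahnℕ-step₀ : ∀ {q} N p x → 1 < q → x ≤ p → QHahnℕ q (suc N) (suc p) 0 x ≡ QHahnℕ q N p 0 x
QHahnℕ-step₀ {q} N p x 1<q x≤p =
  recombine₁ {C * D̃⁻¹} {hahnSum q (suc N) (suc p) 0 x} {hahnSum q N p 0 x} {qint q (suc p ∸ x)} {qint q (suc p)} {C * D⁻¹}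
    (qint-≢0 (suc p ∸ x) 1<q (ℕP.m<n⇒0<n∸m (s≤s x≤p))) (hahnSum-step₀ N p x 1<q x≤p) (begin
      C * D̃⁻¹ * qint q (suc p)    ≡⟨ ℚP.*-assoc C D̃⁻¹ _ ⟩
      C * (D̃⁻¹ * qint q (suc p))  ≡⟨ cong (C *_) (hahnDenom-step N p x 1<q x≤p) ⟩
      C * (D⁻¹ * qint q (suc p ∸ x)) ≡⟨ sym (ℚP.*-assoc C D⁻¹ _) ⟩
      C * D⁻¹ * qint q (suc p ∸ x)  ∎)
  where
  C D̃⁻¹ D⁻¹ : ℚ
  C = qbinDiff q N 0
  D̃⁻¹ = inv (hahnDenom q (suc N) (suc p) x)
  D⁻¹ = inv (hahnDenom q N p x)

QHahn-inRange : ∀ q N p r x → r ≤ p ⊓ (N ∸ p) → x ≤ p ⊓ (N ∸ p) → QHahn q N p (+ r) (+ x) ≡ QHahnℕ q N p r x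
QHahn-inRange q N p r x r≤ x≤ = if-cong (Equivalence.to T-≡ (Equivalence.from T-∧ (ℕP.≤⇒≤ᵇ r≤ , ℕP.≤⇒≤ᵇ x≤)))

QHahn-step : ∀ {q} N p r x → 1 < q → x ≤ p ⊓ (N ∸ p) → suc r ≤ suc p ⊓ (N ∸ p) →
  QHahn q (suc N) (suc p) (+ suc r) (+ x)
  ≡ (qint q (suc N) ÷ qint q (suc p))
    * ((qint q (p ∸ r) ÷ qint q (suc N ∸ 2 ℕ.* suc r)) * QHahn q N p (+ suc r) (+ x)
       + qpow q (suc p ∸ suc r ℕ.+ 1) * (qint q (N ∸ p ∸ suc r ℕ.+ 1) ÷ qint q (suc N ∸ 2 ℕ.* suc r ℕ.+ 2))
         * QHahn q N p (+ r) (+ x))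
QHahn-step {q} N p r x 1<q x≤ r≤ = begin
  QHahn q (suc N) (suc p) (+ suc r) (+ x)
    ≡⟨ QHahn-inRange q (suc N) (suc p) (suc r) x r≤ (ℕP.≤-trans x≤ (ℕP.⊓-monoˡ-≤ (N ∸ p) (ℕP.n≤1+n p))) ⟩
  QHahnℕ q (suc N) (suc p) (suc r) x
    ≡⟨ QHahnℕ-step N p r x 1<q r≤p r<N∸p (ℕP.m≤n⊓o⇒m≤n p (N ∸ p) x≤) ⟩
  KN ÷ P * (c₁ * QHahnℕ q N p (suc r) x + c₂ * QHahnℕ q N p r x)
    ≡⟨ cong₂ (λ y z → KN ÷ P * (y + c₂ * z)) first
         (sym (QHahn-inRange q N p r x (ℕP.⊓-glb r≤p (ℕP.<⇒≤ r<N∸p)) x≤)) ⟩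
  KN ÷ P * (c₁ * QHahn q N p (+ suc r) (+ x) + c₂ * QHahn q N p (+ r) (+ x)) ∎
  where
  r≤p : r ≤ p
  r≤p = ℕP.≤-pred (ℕP.m≤n⊓o⇒m≤n (suc p) (N ∸ p) r≤)
  r<N∸p : suc r ≤ N ∸ p
  r<N∸p = ℕP.m≤n⊓o⇒m≤o (suc p) (N ∸ p) r≤
  KN P c₁ c₂ : ℚ
  KN = qint q (suc N)
  P = qint q (suc p)
  c₁ = qint q (p ∸ r) ÷ qint q (suc N ∸ 2 ℕ.* suc r)
  c₂ = qpow q (suc p ∸ suc r ℕ.+ 1) * (qint q (N ∸ p ∸ suc r ℕ.+ 1) ÷ qint q (suc N ∸ 2 ℕ.* suc r ℕ.+ 2))
  -- When r = p, suc r is out of range for (N, p), but then c₁ has the factor [p ∸ r] = [0].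
  first : c₁ * QHahnℕ q N p (suc r) x ≡ c₁ * QHahn q N p (+ suc r) (+ x)
  first = [ (λ r<p → cong (c₁ *_) (sym (QHahn-inRange q N p (suc r) x (ℕP.⊓-glb r<p r<N∸p) x≤)))
          , (λ r≡p → zero-factor (QHahnℕ q N p (suc r) x) (QHahn q N p (+ suc r) (+ x)) (c₁≡0 r≡p))
          ]′ (ℕP.m≤n⇒m<n∨m≡n r≤p)
    where
    zero-factor : ∀ {c} a b → c ≡ 0ℚ → c * a ≡ c * b
    zero-factor a b refl = trans (ℚP.*-zeroˡ a) (sym (ℚP.*-zeroˡ b))
    c₁≡0 : r ≡ p → c₁ ≡ 0ℚ
    c₁≡0 r≡p = begin
      qint q (p ∸ r) ÷ k  ≡⟨ cong (λ i → qint q i ÷ k) (trans (cong (p ∸_) r≡p) (ℕP.n∸n≡0 p)) ⟩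
      qint q 0 ÷ k        ≡⟨ cong (_÷ k) (qint-0 q) ⟩
      0ℚ ÷ k              ≡⟨ ℚP.*-zeroˡ (inv k) ⟩
      0ℚ                  ∎
      where
      k : ℚ
      k = qint q (suc N ∸ 2 ℕ.* suc r)

primePower>1 : ∀ {q} → IsPrimePower q → 1 < q
primePower>1 (ℓ , k , ℓ-prime , refl) =
  ℕP.^-monoʳ-< ℓ (ℕ.nonTrivial⇒n>1 ℓ {{prime⇒nonTrivial ℓ-prime}}) {0} {suc k} (s≤s z≤n)

lemma5p1 : (q N p x r : ℕ) → IsPrimePower q → 0 < p → p < N →
    x ≤ (p ∸ 1) ⊓ (N ∸ p) → r ≤ p ⊓ (N ∸ p) →
    QHahn q N p (+ r) (+ x)
      ≡ (qint q N ÷ qint q p)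
        * ((qint q (p ∸ r) ÷ qint q (N ∸ 2 ℕ.* r))
             * QHahn q (N ∸ 1) (p ∸ 1) (+ r) (+ x)
           + qpow q (p ∸ r ℕ.+ 1) * (qint q (N ∸ p ∸ r ℕ.+ 1) ÷ qint q (N ∸ 2 ℕ.* r ℕ.+ 2))
             * QHahn q (N ∸ 1) (p ∸ 1) (+ r ℤ.- ℤ.1ℤ) (+ x))
lemma5p1 q (suc N) (suc p) x zero q-pp _ _ x≤ _ = begin
  QHahn q (suc N) (suc p) (+ 0) (+ x)
    ≡⟨ QHahn-inRange q (suc N) (suc p) 0 x z≤n (ℕP.≤-trans x≤ (ℕP.⊓-monoˡ-≤ (N ∸ p) (ℕP.n≤1+n p))) ⟩
  QHahnℕ q (suc N) (suc p) 0 x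
    ≡⟨ QHahnℕ-step₀ N p x 1<q (ℕP.m≤n⊓o⇒m≤n p (N ∸ p) x≤) ⟩
  QHahnℕ q N p 0 x
    ≡⟨ QHahn-inRange q N p 0 x z≤n x≤ ⟨
  Q₀
    ≡⟨ ÷-*-÷-cancel Q₀ (qint-≢0 (suc N) 1<q (s≤s z≤n)) (qint-≢0 (suc p) 1<q (s≤s z≤n)) ⟩
  KN ÷ P * (P ÷ KN * Q₀)
    ≡⟨ cong (KN ÷ P *_) (ℚP.+-identityʳ (P ÷ KN * Q₀)) ⟨
  KN ÷ P * (P ÷ KN * Q₀ + 0ℚ)
    ≡⟨ cong (λ y → KN ÷ P * (P ÷ KN * Q₀ + y)) (ℚP.*-zeroʳ c) ⟨
  KN ÷ P * (P ÷ KN * Q₀ + c * 0ℚ) ∎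
  where
  1<q : 1 < q
  1<q = primePower>1 q-pp
  KN P c Q₀ : ℚ
  KN = qint q (suc N)
  P = qint q (suc p)
  c = qpow q (suc p ℕ.+ 1) * (qint q (N ∸ p ℕ.+ 1) ÷ qint q (suc N ℕ.+ 2))
  Q₀ = QHahn q N p (+ 0) (+ x)
lemma5p1 q (suc N) (suc p) x (suc r) q-pp _ _ x≤ r≤ = QHahn-step N p r x (primePower>1 q-pp) x≤ r≤
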